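{- Let $r\ge 1$ and let $n_1,\dots,n_r$ be nonnegative integers. Then the value $\zeta_r(-n_1,\dots,-n_r)$ of Sadaoui's analytic continuation (defined in the context) satisfies \[ \zeta_r(-n_1,\dots,-n_r)=\prod_{k=1}^{r}(-1)^{n_k}\,\mathcal{C}_{1,\dots,k}^{\,n_k+1}, \] where the right-hand side is evaluated by the symbolic rules in the context; explicitly, \[ \zeta_r(-n_1,\dots,-n_r)=(-1)^{n_1+\dots+n_r}\,V(n_1+1,\dots,n_r+1). \]
   Context: Bernoulli numbers $B_m$ are defined by $\frac{t}{e^t-1}=\sum_{m\ge0}B_m\frac{t^m}{m!}$, so $B_0=1$, $B_1=-\tfrac12$, $B_2=\tfrac16$. The Euler–Zagier multiple zeta function is $\zeta_r(s_1,\dots,s_r)=\sum_{0<k_1<\dots<k_r}k_1^{ -s_1}\cdots k_r^{ -s_r}$. Sadaoui's analytic continuation to nonpositive integer arguments is given by the following explicit formula. Let $\bar n=\sum_{j=1}^r n_j$. For integers $k_2,\dots,k_r$ put $\bar k=\sum_{j=2}^r k_j$, $m_1=\bar n+r-\bar k$, and for $2\le j\le r$ \[ m_j=\sum_{i=j}^r n_i+(r-j+1)-\sum_{i=j+1}^r k_i . \] Note that $m_j$ depends only on $k_{j+1},\dots,k_r$. The outer sum runs over all tuples $(k_2,\dots,k_r)$ with $0\le k_j\le m_j$ for $j=r,r-1,\dots,2$. Define \[ \zeta_r(-n_1,\dots,-n_r)=(-1)^r\sum_{k_2,\dots,k_r}\frac{1}{m_1}\prod_{j=2}^r\frac{\binom{m_j}{k_j}}{m_j}\sum_{l_1=0}^{m_1}\sum_{l_2=0}^{k_2}\cdots\sum_{l_r=0}^{k_r}\binom{m_1}{l_1}\prod_{j=2}^r\binom{k_j}{l_j}\,B_{l_1}B_{l_2}\cdots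 B_{l_r}. \] For $r=1$ the outer sum and the product are empty and $m_1=n_1+1$. Symbolic calculus. Let $\mathcal{B}_1,\dots,\mathcal{B}_r$ be independent Bernoulli symbols. A monomial $\mathcal{B}_1^{p_1}\cdots\mathcal{B}_r^{p_r}$ is evaluated as $B_{p_1}\cdots B_{p_r}$; in particular $\mathcal{B}_k^p\mathcal{B}_k^q\to B_{p+q}$. The symbols $\mathcal{C}_{1,\dots,k}$ are defined by \[ \mathcal{C}_1^n=\frac{\mathcal{B}_1^n}{n},\qquad \mathcal{C}_{1,\dots,k+1}^n=\frac{(\mathcal{C}_{1,\dots,k}+\mathcal{B}_{k+1})^n}{n}. \] A product of such symbols is evaluated as follows. Expand each $\mathcal{C}$-power binomially, starting from the highest index. Combine powers of the same symbol additively. Only then substitute the lower-level definitions and apply the Bernoulli evaluation rules. Concretely, for positive integers $a_1,\dots,a_k$ the evaluated value $V(a_1,\dots,a_k)$ of $\mathcal{C}_1^{a_1}\mathcal{C}_{1,2}^{a_2}\cdots\mathcal{C}_{1,\dots,k}^{a_k}$ is given recursively by $V(a_1)=B_{a_1}/a_1$ and, for $k\ge2$, \[ V(a_1,\dots,a_k)=\frac{1}{a_k}\sum_{j=0}^{a_k}\binom{a_k}{j}B_{a_k-j}\,V(a_1,\dots,a_{k-2},a_{k-1}+j). \] -}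

module Defs where

open import Data.Nat as ℕ using (ℕ; zero; suc)
open import Data.Nat.Combinatorics using (_C_)
open import Data.Integer using (+_)
open import Data.Nat.ListAction using (sum)
open import Data.List using (List; []; _∷_; upTo; map; length; reverse; zip; concatMap; foldr)
open import Data.Product using (_,_; _×_)
open import Data.Rational using (ℚ; _/_; 0ℚ; 1ℚ; _+_; _*_; -_)

ℕ→ℚ : ℕ → ℚ
ℕ→ℚ n = + n / 1

-- 1/n for n ≥ 1 (recip 0 = 0; it is only ever applied to positive numbers here)
recip : ℕ → ℚ
recip zero = 0ℚ
recip (suc n) = + 1 / suc n

sumℚ : List ℚ → ℚ
sumℚ = foldr _+_ 0ℚ

Σ≤ : ℕ → (ℕ → ℚ) → ℚ
Σ≤ m f = sumℚ (map f (upTo (suc m)))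

sgn : ℕ → ℚ
sgn zero = 1ℚ
sgn (suc n) = - sgn n

-- [B_n, B_{n-1}, ..., B_0], via B_0 = 1 and
-- B_m = -(1/(m+1)) Σ_{k<m} C(m+1,k) B_k   (the t/(e^t-1) convention, B_1 = -1/2)
revBern : ℕ → List ℚ
revBern zero = 1ℚ ∷ []
revBern (suc n) =
  (- (recip (suc (suc n)) *
      sumℚ (map (λ { (k , b) → ℕ→ℚ (suc (suc n) C k) * b })
                (zip (upTo (suc n)) (reverse (revBern n))))))
  ∷ revBern n

B : ℕ → ℚ
B n with revBern n
... | b ∷ _ = b
... | [] = 0ℚ

-- For ns = [n_j, ..., n_r] and ks = [k_{j+1}, ..., k_r]:
--   m = Σ_{i≥j} n_i + (r-j+1) - Σ_{i>j} k_i   (this is m_j; for j = 1 it is m_1)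
mOf : List ℕ → List ℕ → ℕ
mOf ns ks = (sum ns ℕ.+ length ns) ℕ.∸ sum ks

-- For ns = [n_j, ..., n_r] (j ≥ 2): all tuples [k_j, ..., k_r] with
-- 0 ≤ k_i ≤ m_i, chosen for i = r, r-1, ..., j.
tuples : List ℕ → List (List ℕ)
tuples [] = [] ∷ []
tuples (n ∷ ns) =
  concatMap (λ ks → map (λ k → k ∷ ks) (upTo (suc (mOf (n ∷ ns) ks)))) (tuples ns)

prodW : List ℕ → List ℕ → ℚ
prodW (n ∷ ns) (k ∷ ks) =
  ℕ→ℚ (mOf (n ∷ ns) ks C k) * recip (mOf (n ∷ ns) ks) * prodW ns ks
prodW _ _ = 1ℚ

nest : List ℕ → ℚ
nest [] = 1ℚ
nest (k ∷ ks) = Σ≤ k (λ l → ℕ→ℚ (k C l) * B l * nest ks)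

zetaNeg : List ℕ → ℚ
zetaNeg [] = 0ℚ   -- r = 0: not used
zetaNeg (n₁ ∷ ns) =
  sgn (length (n₁ ∷ ns)) *
  sumℚ (map (λ ks →
    recip (mOf (n₁ ∷ ns) ks) * prodW ns ks *
    Σ≤ (mOf (n₁ ∷ ns) ks) (λ l₁ →
      ℕ→ℚ (mOf (n₁ ∷ ns) ks C l₁) * B l₁ * nest ks))
    (tuples ns))

-- Vrev a [a_{k-1}, ..., a_1] with a = a_k implements
--   V(a_1) = B_{a_1}/a_1,
--   V(a_1..a_k) = (1/a_k) Σ_{j=0}^{a_k} C(a_k,j) B_{a_k-j} V(a_1..a_{k-2}, a_{k-1}+j).
Vrev : ℕ → List ℕ → ℚ
Vrev a [] = B a * recip a
Vrev a (b ∷ rest) =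
  recip a * Σ≤ a (λ j → ℕ→ℚ (a C j) * B (a ℕ.∸ j) * Vrev (b ℕ.+ j) rest)

V : List ℕ → ℚ
V as with reverse as
... | [] = 1ℚ   -- empty tuple: not used
... | a ∷ rest = Vrev a rest

-- The inner Bernoulli sums of Sadaoui's formula are B⁺ₘ = Σⱼ C(m,j) Bⱼ = (-1)ᵐ Bₘ: both (-1)ⁿ B⁺ₙ
-- and Bₙ solve Σ_{k<N} C(N,k) xₖ = [N = 1], which determines the sequence. Since
-- m_{j-1} = n_{j-1} + 1 + m_j - k_j, summing over k_2, k_3, … one at a time turns Sadaoui's sum into
-- an iteration of h ↦ (m ↦ (1/m) Σₖ C(m,k) B⁺ₖ h(n + 1 + m - k)), one factor per variable.
-- Extracting the signs leaves (-1)^(n_1 + … + n_r + r) times the same iteration with Bₖ for B⁺ₖ,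
-- and the substitution j = m - k turns that iteration into the recursion defining V.

module Submission where

open import Defs
open import Data.Nat using (ℕ; suc)
open import Data.List using (List; _∷_; map)
open import Data.Nat.ListAction using (sum)
open import Data.Rational using (_*_)
open import Relation.Binary.PropositionalEquality using (_≡_)

open import Data.Nat as ℕ using (zero; z≤n; s≤s; _≤_; _<_; _!)
import Data.Nat.Properties as ℕP
import Data.Nat.Tactic.RingSolver as ℕSolver
open import Data.Nat.Combinatorics
  using (_C_; nCk≡n!/k![n-k]!; k![n∸k]!∣n!; nCk≡nC[n∸k]; nC1≡n; nCn≡1; k>n⇒nCk≡0; nCk+nC[k+1]≡[n+1]C[k+1])
open import Data.Nat.DivMod using (m/n*n≡m)
open import Data.Nat.Induction using (<-rec)
open import Data.Nat.Coprimality using (1-coprimeTo) renaming (sym to coprime-sym)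
import Data.Integer as ℤ
import Data.Integer.Properties as ℤP
open import Data.Rational using (ℚ; mkℚ; _/_; 0ℚ; 1ℚ; _+_; -_)
import Data.Rational.Properties as ℚP
open import Algebra.Properties.Group ℚP.+-0-group using (∙-cancelˡ)
open import Data.List using ([]; applyUpTo; upTo; reverse; zip; _∷ʳ_; _++_; concatMap; length)
import Data.List.Properties as List
open import Data.Product using (_,_; _×_)
open import Data.Sum using (inj₁; inj₂)
open import Data.Maybe using (Maybe; just; nothing)
open import Function using (_∘_)
open import Level using (0ℓ)
open import Relation.Nullary using (yes; no)
open import Relation.Binary.PropositionalEquality using (refl; sym; trans; cong; cong₂; subst; module ≡-Reasoning)
open import Tactic.RingSolver using (solve-∀)
open import Tactic.RingSolver.Core.AlmostCommutativeRing using (AlmostCommutativeRing; fromCommutativeRing)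

ℚ-ring : AlmostCommutativeRing 0ℓ 0ℓ
ℚ-ring = fromCommutativeRing ℚP.+-*-commutativeRing isZero
  where
  isZero : ∀ x → Maybe (0ℚ ≡ x)
  isZero x with 0ℚ ℚP.≟ x
  ... | yes p = just p
  ... | no _ = nothing

Σ : ℕ → (ℕ → ℚ) → ℚ
Σ zero f = 0ℚ
Σ (suc n) f = f 0 + Σ n (f ∘ suc)

sumℚ-applyUpTo : ∀ n (f : ℕ → ℚ) → sumℚ (applyUpTo f n) ≡ Σ n f
sumℚ-applyUpTo zero f = refl
sumℚ-applyUpTo (suc n) f = cong (f 0 +_) (sumℚ-applyUpTo n (f ∘ suc))

sumℚ-map-upTo : ∀ n f → sumℚ (map f (upTo n)) ≡ Σ n f
sumℚ-map-upTo n f = trans (cong sumℚ (List.map-upTo f n)) (sumℚ-applyUpTo n f)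

Σ≤≡Σ : ∀ m f → Σ≤ m f ≡ Σ (suc m) f
Σ≤≡Σ m = sumℚ-map-upTo (suc m)

Σ-cong : ∀ n {f g : ℕ → ℚ} → (∀ i → i < n → f i ≡ g i) → Σ n f ≡ Σ n g
Σ-cong zero eq = refl
Σ-cong (suc n) eq = cong₂ _+_ (eq 0 (s≤s z≤n)) (Σ-cong n (λ i i<n → eq (suc i) (s≤s i<n)))

Σ-cong′ : ∀ n {f g : ℕ → ℚ} → (∀ i → f i ≡ g i) → Σ n f ≡ Σ n g
Σ-cong′ n eq = Σ-cong n (λ i _ → eq i)

Σ-snoc : ∀ n f → Σ (suc n) f ≡ Σ n f + f n
Σ-snoc zero f = trans (ℚP.+-identityʳ (f 0)) (sym (ℚP.+-identityˡ (f 0)))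
Σ-snoc (suc n) f = trans (cong (f 0 +_) (Σ-snoc n (f ∘ suc))) (sym (ℚP.+-assoc (f 0) _ _))

Σ-+ : ∀ n f g → Σ n (λ i → f i + g i) ≡ Σ n f + Σ n g
Σ-+ zero f g = refl
Σ-+ (suc n) f g = trans (cong ((f 0 + g 0) +_) (Σ-+ n (f ∘ suc) (g ∘ suc))) (interchange (f 0) (g 0) _ _)
  where
  interchange : ∀ a b c d → (a + b) + (c + d) ≡ (a + c) + (b + d)
  interchange = solve-∀ ℚ-ring

Σ-*ˡ : ∀ n c f → Σ n (λ i → c * f i) ≡ c * Σ n f
Σ-*ˡ zero c f = sym (ℚP.*-zeroʳ c)
Σ-*ˡ (suc n) c f = trans (cong (c * f 0 +_) (Σ-*ˡ n c (f ∘ suc))) (sym (ℚP.*-distribˡ-+ c (f 0) _))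

Σ-*ʳ : ∀ n c f → Σ n (λ i → f i * c) ≡ Σ n f * c
Σ-*ʳ n c f = trans (Σ-cong′ n (λ i → ℚP.*-comm (f i) c)) (trans (Σ-*ˡ n c f) (ℚP.*-comm c _))

Σ-neg : ∀ n f → Σ n (λ i → - f i) ≡ - Σ n f
Σ-neg zero f = refl
Σ-neg (suc n) f = trans (cong (- f 0 +_) (Σ-neg n (f ∘ suc))) (sym (ℚP.neg-distrib-+ (f 0) _))

Σ-reverse : ∀ n f → Σ n f ≡ Σ n (λ i → f (n ℕ.∸ suc i))
Σ-reverse zero f = refl
Σ-reverse (suc n) f = begin
  f 0 + Σ n (f ∘ suc)                       ≡⟨ cong (f 0 +_) (Σ-reverse n (f ∘ suc)) ⟩
  f 0 + Σ n (λ i → f (suc (n ℕ.∸ suc i)))   ≡⟨ ℚP.+-comm (f 0) _ ⟩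
  Σ n (λ i → f (suc (n ℕ.∸ suc i))) + f 0   ≡⟨ cong₂ _+_ (Σ-cong n (λ i i<n → cong f (sym (ℕP.+-∸-assoc 1 i<n))))
                                                         (cong f (sym (ℕP.n∸n≡0 n))) ⟩
  Σ n (λ i → f (n ℕ.∸ i)) + f (n ℕ.∸ n)     ≡⟨ Σ-snoc n (λ i → f (n ℕ.∸ i)) ⟨
  Σ (suc n) (λ i → f (n ℕ.∸ i))             ∎
  where open ≡-Reasoning

Σ-exchange : ∀ N (F : ℕ → ℕ → ℚ) →
             Σ N (λ k → Σ (suc k) (F k)) ≡ Σ N (λ j → Σ (N ℕ.∸ j) (λ i → F (j ℕ.+ i) j))
Σ-exchange zero F = refl
Σ-exchange (suc N) F = begin
  Σ (suc N) (λ k → Σ (suc k) (F k))           ≡⟨ Σ-snoc N _ ⟩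
  Σ N (λ k → Σ (suc k) (F k)) + Σ (suc N) (F N) ≡⟨ cong (_+ Σ (suc N) (F N)) (Σ-exchange N F) ⟩
  Σ N (G N) + Σ (suc N) (F N)                 ≡⟨ cong (_+ Σ (suc N) (F N)) (trans (sym (ℚP.+-identityʳ (Σ N (G N))))
                                                   (cong (λ m → Σ N (G N) + Σ m (λ i → F (N ℕ.+ i) N)) (sym (ℕP.n∸n≡0 N)))) ⟩
  (Σ N (G N) + G N N) + Σ (suc N) (F N)       ≡⟨ cong (_+ Σ (suc N) (F N)) (Σ-snoc N (G N)) ⟨
  Σ (suc N) (G N) + Σ (suc N) (F N)           ≡⟨ Σ-+ (suc N) (G N) (F N) ⟨
  Σ (suc N) (λ j → G N j + F N j)             ≡⟨ Σ-cong (suc N) extend ⟩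
  Σ (suc N) (G (suc N))                       ∎
  where
  open ≡-Reasoning
  G : ℕ → ℕ → ℚ
  G M j = Σ (M ℕ.∸ j) (λ i → F (j ℕ.+ i) j)
  extend : ∀ j → j < suc N → G N j + F N j ≡ G (suc N) j
  extend j (s≤s j≤N) = begin
    G N j + F N j                           ≡⟨ cong (λ k → G N j + F k j) (sym (ℕP.m+[n∸m]≡n j≤N)) ⟩
    G N j + F (j ℕ.+ (N ℕ.∸ j)) j           ≡⟨ Σ-snoc (N ℕ.∸ j) (λ i → F (j ℕ.+ i) j) ⟨
    Σ (suc (N ℕ.∸ j)) (λ i → F (j ℕ.+ i) j) ≡⟨ cong (λ m → Σ m (λ i → F (j ℕ.+ i) j)) (sym (ℕP.+-∸-assoc 1 j≤N)) ⟩
    G (suc N) j                             ∎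

sumℚ-++ : ∀ xs ys → sumℚ (xs ++ ys) ≡ sumℚ xs + sumℚ ys
sumℚ-++ [] ys = sym (ℚP.+-identityˡ (sumℚ ys))
sumℚ-++ (x ∷ xs) ys = trans (cong (x +_) (sumℚ-++ xs ys)) (sym (ℚP.+-assoc x (sumℚ xs) (sumℚ ys)))

sumℚ-concatMap : ∀ {A B : Set} (f : B → ℚ) (g : A → List B) xs →
                 sumℚ (map f (concatMap g xs)) ≡ sumℚ (map (λ x → sumℚ (map f (g x))) xs)
sumℚ-concatMap f g [] = refl
sumℚ-concatMap f g (x ∷ xs) = begin
  sumℚ (map f (g x ++ concatMap g xs))                ≡⟨ cong sumℚ (List.map-++ f (g x) (concatMap g xs)) ⟩
  sumℚ (map f (g x) ++ map f (concatMap g xs))        ≡⟨ sumℚ-++ (map f (g x)) _ ⟩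
  sumℚ (map f (g x)) + sumℚ (map f (concatMap g xs))  ≡⟨ cong (sumℚ (map f (g x)) +_) (sumℚ-concatMap f g xs) ⟩
  sumℚ (map f (g x)) + sumℚ (map (λ x → sumℚ (map f (g x))) xs) ∎
  where open ≡-Reasoning

ℕ→ℚ≡mkℚ : ∀ n → ℕ→ℚ n ≡ mkℚ (ℤ.+ n) 0 (coprime-sym (1-coprimeTo n))
ℕ→ℚ≡mkℚ n = ℚP.normalize-coprime (coprime-sym (1-coprimeTo n))

ℕ→ℚ-+ : ∀ a b → ℕ→ℚ (a ℕ.+ b) ≡ ℕ→ℚ a + ℕ→ℚ b
ℕ→ℚ-+ a b = sym (trans (cong₂ _+_ (ℕ→ℚ≡mkℚ a) (ℕ→ℚ≡mkℚ b))
  (cong (_/ 1) (trans (cong₂ ℤ._+_ (ℤP.*-identityʳ (ℤ.+ a)) (ℤP.*-identityʳ (ℤ.+ b))) (sym (ℤP.pos-+ a b)))))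

ℕ→ℚ-* : ∀ a b → ℕ→ℚ (a ℕ.* b) ≡ ℕ→ℚ a * ℕ→ℚ b
ℕ→ℚ-* a b = sym (trans (cong₂ _*_ (ℕ→ℚ≡mkℚ a) (ℕ→ℚ≡mkℚ b)) (cong (_/ 1) (sym (ℤP.pos-* a b))))

ℕ→ℚ*recip≡1 : ∀ k → ℕ→ℚ (suc k) * recip (suc k) ≡ 1ℚ
ℕ→ℚ*recip≡1 k = trans (cong₂ _*_ (ℕ→ℚ≡mkℚ (suc k)) (ℚP.normalize-coprime (1-coprimeTo (suc k))))
  (ℚP.*-inverseʳ (mkℚ (ℤ.+ suc k) 0 (coprime-sym (1-coprimeTo (suc k)))))

ℕ→ℚ-*-cancelˡ : ∀ k x y → ℕ→ℚ (suc k) * x ≡ ℕ→ℚ (suc k) * y → x ≡ y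
ℕ→ℚ-*-cancelˡ k x y eq = begin
  x                            ≡⟨ unit x ⟩
  (r * c) * x                  ≡⟨ ℚP.*-assoc r c x ⟩
  r * (c * x)                  ≡⟨ cong (r *_) eq ⟩
  r * (c * y)                  ≡⟨ ℚP.*-assoc r c y ⟨
  (r * c) * y                  ≡⟨ unit y ⟨
  y                            ∎
  where
  open ≡-Reasoning
  r = recip (suc k)
  c = ℕ→ℚ (suc k)
  unit : ∀ z → z ≡ (r * c) * z
  unit z = sym (trans (cong (_* z) (trans (ℚP.*-comm r c) (ℕ→ℚ*recip≡1 k))) (ℚP.*-identityˡ z))

sgn-+ : ∀ a b → sgn (a ℕ.+ b) ≡ sgn a * sgn b
sgn-+ zero b = sym (ℚP.*-identityˡ (sgn b))
sgn-+ (suc a) b = trans (cong -_ (sgn-+ a b)) (ℚP.neg-distribˡ-* (sgn a) (sgn b))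

sgn*sgn≡1 : ∀ a → sgn a * sgn a ≡ 1ℚ
sgn*sgn≡1 zero = refl
sgn*sgn≡1 (suc a) = trans (negSquare (sgn a)) (sgn*sgn≡1 a)
  where
  negSquare : ∀ x → (- x) * (- x) ≡ x * x
  negSquare = solve-∀ ℚ-ring

sgn-absorb : ∀ m n x → sgn n * (sgn (m ℕ.+ n) * x) ≡ sgn m * x
sgn-absorb m n x = begin
  sgn n * (sgn (m ℕ.+ n) * x)      ≡⟨ cong (λ s → sgn n * (s * x)) (sgn-+ m n) ⟩
  sgn n * (sgn m * sgn n * x)      ≡⟨ regroup (sgn n) (sgn m) x ⟩
  sgn m * (sgn n * sgn n) * x      ≡⟨ cong (λ s → sgn m * s * x) (sgn*sgn≡1 n) ⟩
  sgn m * 1ℚ * x                   ≡⟨ cong (_* x) (ℚP.*-identityʳ (sgn m)) ⟩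
  sgn m * x                        ∎
  where
  open ≡-Reasoning
  regroup : ∀ t s x → t * (s * t * x) ≡ s * (t * t) * x
  regroup = solve-∀ ℚ-ring

nCk*[k!*[n∸k]!]≡n! : ∀ {n k} → k ≤ n → (n C k) ℕ.* (k ! ℕ.* (n ℕ.∸ k) !) ≡ n !
nCk*[k!*[n∸k]!]≡n! {n} {k} k≤n =
  trans (cong (ℕ._* (k ! ℕ.* (n ℕ.∸ k) !)) (nCk≡n!/k![n-k]! k≤n))
        (m/n*n≡m {{ℕP._!*_!≢0 k (n ℕ.∸ k)}} (k![n∸k]!∣n! k≤n))

nC[j+i]*[j+i]Cj≡nCj*[n∸j]Ci : ∀ n j i → j ℕ.+ i ≤ n →
                              (n C (j ℕ.+ i)) ℕ.* ((j ℕ.+ i) C j) ≡ (n C j) ℕ.* ((n ℕ.∸ j) C i)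
nC[j+i]*[j+i]Cj≡nCj*[n∸j]Ci n j i j+i≤n = ℕP.*-cancelʳ-≡ _ _ D {{D≢0}} (trans lhs≡n! (sym rhs≡n!))
  where
  open ≡-Reasoning
  R = (n ℕ.∸ (j ℕ.+ i)) !
  D = j ! ℕ.* (i ! ℕ.* R)
  D≢0 : ℕ.NonZero D
  D≢0 = ℕP.m*n≢0 (j !) (i ! ℕ.* R) {{ℕP._!≢0 j}} {{ℕP._!*_!≢0 i (n ℕ.∸ (j ℕ.+ i))}}
  a = n C (j ℕ.+ i)
  b = (j ℕ.+ i) C j
  c = n C j
  d = (n ℕ.∸ j) C i
  regroupˡ : ∀ a b x y r → (a ℕ.* b) ℕ.* (x ℕ.* (y ℕ.* r)) ≡ a ℕ.* ((b ℕ.* (x ℕ.* y)) ℕ.* r)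
  regroupˡ = ℕSolver.solve-∀
  regroupʳ : ∀ c d x y r → (c ℕ.* d) ℕ.* (x ℕ.* (y ℕ.* r)) ≡ c ℕ.* (x ℕ.* (d ℕ.* (y ℕ.* r)))
  regroupʳ = ℕSolver.solve-∀
  lhs≡n! : (a ℕ.* b) ℕ.* D ≡ n !
  lhs≡n! = begin
    (a ℕ.* b) ℕ.* D                                     ≡⟨ regroupˡ a b (j !) (i !) R ⟩
    a ℕ.* ((b ℕ.* (j ! ℕ.* i !)) ℕ.* R)                 ≡⟨ cong (λ z → a ℕ.* ((b ℕ.* (j ! ℕ.* z !)) ℕ.* R)) (sym (ℕP.m+n∸m≡n j i)) ⟩
    a ℕ.* ((b ℕ.* (j ! ℕ.* ((j ℕ.+ i) ℕ.∸ j) !)) ℕ.* R) ≡⟨ cong (λ z → a ℕ.* (z ℕ.* R)) (nCk*[k!*[n∸k]!]≡n! (ℕP.m≤m+n j i)) ⟩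
    a ℕ.* ((j ℕ.+ i) ! ℕ.* R)                           ≡⟨ nCk*[k!*[n∸k]!]≡n! j+i≤n ⟩
    n !                                                 ∎
  rhs≡n! : (c ℕ.* d) ℕ.* D ≡ n !
  rhs≡n! = begin
    (c ℕ.* d) ℕ.* D                                       ≡⟨ regroupʳ c d (j !) (i !) R ⟩
    c ℕ.* (j ! ℕ.* (d ℕ.* (i ! ℕ.* R)))                   ≡⟨ cong (λ z → c ℕ.* (j ! ℕ.* (d ℕ.* (i ! ℕ.* z !)))) (sym (ℕP.∸-+-assoc n j i)) ⟩
    c ℕ.* (j ! ℕ.* (d ℕ.* (i ! ℕ.* (n ℕ.∸ j ℕ.∸ i) !)))   ≡⟨ cong (λ z → c ℕ.* (j ! ℕ.* z))
                                                               (nCk*[k!*[n∸k]!]≡n! (ℕP.m+n≤o⇒m≤o∸n i (subst (_≤ n) (ℕP.+-comm j i) j+i≤n))) ⟩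
    c ℕ.* (j ! ℕ.* (n ℕ.∸ j) !)                           ≡⟨ nCk*[k!*[n∸k]!]≡n! (ℕP.m+n≤o⇒m≤o j j+i≤n) ⟩
    n !                                                   ∎

[1+n]Cn≡1+n : ∀ n → (suc n C n) ≡ suc n
[1+n]Cn≡1+n n = trans (nCk≡nC[n∸k] (ℕP.n≤1+n n)) (trans (cong (suc n C_) (ℕP.m+n∸n≡m 1 n)) (nC1≡n (suc n)))

alternating-binomial-sum : ∀ M → Σ (suc M) (λ i → ℕ→ℚ (suc M C i) * sgn i) ≡ - sgn (suc M)
alternating-binomial-sum M = begin
  Σ (suc M) (a (suc M))                                      ≡⟨ addSub _ _ ⟩
  (Σ (suc M) (a (suc M)) + a (suc M) (suc M)) + - a (suc M) (suc M) ≡⟨ cong (_+ - a (suc M) (suc M)) (sym (Σ-snoc (suc M) (a (suc M)))) ⟩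
  Σ (suc (suc M)) (a (suc M)) + - a (suc M) (suc M)          ≡⟨ cong (_+ - a (suc M) (suc M)) fullSum≡0 ⟩
  0ℚ + - a (suc M) (suc M)                                   ≡⟨ ℚP.+-identityˡ _ ⟩
  - (ℕ→ℚ (suc M C suc M) * sgn (suc M))                      ≡⟨ cong (λ z → - (ℕ→ℚ z * sgn (suc M))) (nCn≡1 (suc M)) ⟩
  - (1ℚ * sgn (suc M))                                       ≡⟨ cong -_ (ℚP.*-identityˡ _) ⟩
  - sgn (suc M)                                              ∎
  where
  open ≡-Reasoning
  a : ℕ → ℕ → ℚ
  a m i = ℕ→ℚ (m C i) * sgn i
  A = Σ (suc M) (a M)
  A′ = Σ (suc M) (a M ∘ suc)
  addSub : ∀ x y → x ≡ (x + y) + - y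
  addSub = solve-∀ ℚ-ring
  pascal : ∀ i → a (suc M) (suc i) ≡ - a M i + a M (suc i)
  pascal i = begin
    ℕ→ℚ (suc M C suc i) * - sgn i                    ≡⟨ cong (λ z → ℕ→ℚ z * - sgn i) (sym (nCk+nC[k+1]≡[n+1]C[k+1] M i)) ⟩
    ℕ→ℚ (M C i ℕ.+ M C suc i) * - sgn i              ≡⟨ cong (_* - sgn i) (ℕ→ℚ-+ (M C i) (M C suc i)) ⟩
    (ℕ→ℚ (M C i) + ℕ→ℚ (M C suc i)) * - sgn i        ≡⟨ distrib (ℕ→ℚ (M C i)) (ℕ→ℚ (M C suc i)) (sgn i) ⟩
    - a M i + a M (suc i)                            ∎
    where
    distrib : ∀ x y s → (x + y) * (- s) ≡ - (x * s) + y * (- s)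
    distrib = solve-∀ ℚ-ring
  shift : A′ + 1ℚ ≡ A
  shift = begin
    A′ + 1ℚ                              ≡⟨ ℚP.+-comm A′ 1ℚ ⟩
    Σ (suc (suc M)) (a M)                ≡⟨ Σ-snoc (suc M) (a M) ⟩
    A + ℕ→ℚ (M C suc M) * sgn (suc M)    ≡⟨ cong (λ z → A + ℕ→ℚ z * sgn (suc M)) (k>n⇒nCk≡0 (ℕP.n<1+n M)) ⟩
    A + 0ℚ * sgn (suc M)                 ≡⟨ cong (A +_) (ℚP.*-zeroˡ (sgn (suc M))) ⟩
    A + 0ℚ                               ≡⟨ ℚP.+-identityʳ A ⟩
    A                                    ∎
  fullSum≡0 : Σ (suc (suc M)) (a (suc M)) ≡ 0ℚ
  fullSum≡0 = begin
    1ℚ + Σ (suc M) (a (suc M) ∘ suc)               ≡⟨ cong (1ℚ +_) (Σ-cong′ (suc M) pascal) ⟩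
    1ℚ + Σ (suc M) (λ i → - a M i + a M (suc i))   ≡⟨ cong (1ℚ +_) (Σ-+ (suc M) (λ i → - a M i) (a M ∘ suc)) ⟩
    1ℚ + (Σ (suc M) (λ i → - a M i) + A′)          ≡⟨ cong (λ z → 1ℚ + (z + A′)) (Σ-neg (suc M) (a M)) ⟩
    1ℚ + (- A + A′)                                ≡⟨ cong (λ z → 1ℚ + (- z + A′)) (sym shift) ⟩
    1ℚ + (- (A′ + 1ℚ) + A′)                        ≡⟨ cancel A′ ⟩
    0ℚ                                             ∎
    where
    cancel : ∀ x → 1ℚ + (- (x + 1ℚ) + x) ≡ 0ℚ
    cancel = solve-∀ ℚ-ring

-- Bernoulli numbers

B-suc : ∀ n → B (suc n) ≡ - (recip (suc (suc n)) * Σ (suc n) (λ k → ℕ→ℚ (suc (suc n) C k) * B k))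
B-suc n = cong (λ z → - (recip (suc (suc n)) * z)) (begin
  sumℚ (map φ (zip (upTo (suc n)) (reverse (revBern n))))     ≡⟨ cong (λ z → sumℚ (map φ (zip (upTo (suc n)) z))) (reverse-revBern n) ⟩
  sumℚ (map φ (zip (upTo (suc n)) (map B (upTo (suc n)))))    ≡⟨ cong (sumℚ ∘ map φ) (zip-map-self (upTo (suc n))) ⟩
  sumℚ (map φ (map (λ k → (k , B k)) (upTo (suc n))))         ≡⟨ cong sumℚ (List.map-∘ {g = φ} {f = λ k → (k , B k)} (upTo (suc n))) ⟨
  sumℚ (map (λ k → ℕ→ℚ (suc (suc n) C k) * B k) (upTo (suc n))) ≡⟨ sumℚ-map-upTo (suc n) (λ k → ℕ→ℚ (suc (suc n) C k) * B k) ⟩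
  Σ (suc n) (λ k → ℕ→ℚ (suc (suc n) C k) * B k)               ∎)
  where
  open ≡-Reasoning
  φ : ℕ × ℚ → ℚ
  φ (k , b) = ℕ→ℚ (suc (suc n) C k) * b
  reverse-revBern : ∀ n → reverse (revBern n) ≡ map B (upTo (suc n))
  reverse-revBern zero = refl
  reverse-revBern (suc n) = begin
    reverse (B (suc n) ∷ revBern n)       ≡⟨ List.unfold-reverse (B (suc n)) (revBern n) ⟩
    reverse (revBern n) ∷ʳ B (suc n)      ≡⟨ cong (_∷ʳ B (suc n)) (reverse-revBern n) ⟩
    map B (upTo (suc n)) ∷ʳ B (suc n)     ≡⟨ List.map-++ B (upTo (suc n)) (suc n ∷ []) ⟨
    map B (upTo (suc n) ∷ʳ suc n)         ≡⟨ cong (map B) (List.upTo-∷ʳ (suc n)) ⟩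
    map B (upTo (suc (suc n)))            ∎
  zip-map-self : ∀ ks → zip ks (map B ks) ≡ map (λ k → (k , B k)) ks
  zip-map-self [] = refl
  zip-map-self (k ∷ ks) = cong ((k , B k) ∷_) (zip-map-self ks)

δ₁ : ℕ → ℚ
δ₁ (suc zero) = 1ℚ
δ₁ _ = 0ℚ

Σ-binomial-B≡δ₁ : ∀ N → Σ N (λ k → ℕ→ℚ (N C k) * B k) ≡ δ₁ N
Σ-binomial-B≡δ₁ zero = refl
Σ-binomial-B≡δ₁ (suc zero) = refl
Σ-binomial-B≡δ₁ (suc (suc n)) = begin
  Σ (suc N′) (λ k → ℕ→ℚ (N C k) * B k)   ≡⟨ Σ-snoc N′ (λ k → ℕ→ℚ (N C k) * B k) ⟩
  S + ℕ→ℚ (N C N′) * B N′                ≡⟨ cong₂ (λ c b → S + ℕ→ℚ c * b) ([1+n]Cn≡1+n N′) (B-suc n) ⟩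
  S + ℕ→ℚ N * - (recip N * S)            ≡⟨ regroup S (ℕ→ℚ N) (recip N) ⟩
  S + - ((ℕ→ℚ N * recip N) * S)          ≡⟨ cong (λ z → S + - (z * S)) (ℕ→ℚ*recip≡1 N′) ⟩
  S + - (1ℚ * S)                         ≡⟨ cancel S ⟩
  0ℚ                                     ∎
  where
  open ≡-Reasoning
  N′ = suc n
  N = suc N′
  S = Σ N′ (λ k → ℕ→ℚ (N C k) * B k)
  regroup : ∀ s x r → s + x * (- (r * s)) ≡ s + - ((x * r) * s)
  regroup = solve-∀ ℚ-ring
  cancel : ∀ s → s + - (1ℚ * s) ≡ 0ℚ
  cancel = solve-∀ ℚ-ring

B⁺ : ℕ → ℚ
B⁺ n = Σ (suc n) (λ j → ℕ→ℚ (n C j) * B j)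

Σ-binomial-chain : ∀ {N j} → j < N →
  Σ (N ℕ.∸ j) (λ i → ℕ→ℚ (N C (j ℕ.+ i)) * sgn (j ℕ.+ i) * ℕ→ℚ ((j ℕ.+ i) C j)) ≡ - sgn N * ℕ→ℚ (N C j)
Σ-binomial-chain {N} {j} j<N = begin
  Σ (N ℕ.∸ j) (λ i → ℕ→ℚ (N C (j ℕ.+ i)) * sgn (j ℕ.+ i) * ℕ→ℚ ((j ℕ.+ i) C j))
    ≡⟨ Σ-cong (N ℕ.∸ j) factor ⟩
  Σ (N ℕ.∸ j) (λ i → c * sgn j * (ℕ→ℚ ((N ℕ.∸ j) C i) * sgn i))
    ≡⟨ Σ-*ˡ (N ℕ.∸ j) (c * sgn j) (λ i → ℕ→ℚ ((N ℕ.∸ j) C i) * sgn i) ⟩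
  c * sgn j * Σ (N ℕ.∸ j) (λ i → ℕ→ℚ ((N ℕ.∸ j) C i) * sgn i)
    ≡⟨ cong (c * sgn j *_) alternating ⟩
  c * sgn j * - sgn (N ℕ.∸ j)
    ≡⟨ regroup c (sgn j) (sgn (N ℕ.∸ j)) ⟩
  - (sgn j * sgn (N ℕ.∸ j)) * c
    ≡⟨ cong (λ s → - s * c) (trans (sym (sgn-+ j (N ℕ.∸ j))) (cong sgn (ℕP.m+[n∸m]≡n (ℕP.<⇒≤ j<N)))) ⟩
  - sgn N * c ∎
  where
  open ≡-Reasoning
  c = ℕ→ℚ (N C j)
  regroup : ∀ c s t → c * s * - t ≡ - (s * t) * c
  regroup = solve-∀ ℚ-ring
  alternating : Σ (N ℕ.∸ j) (λ i → ℕ→ℚ ((N ℕ.∸ j) C i) * sgn i) ≡ - sgn (N ℕ.∸ j)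
  alternating = subst (λ m → Σ m (λ i → ℕ→ℚ (m C i) * sgn i) ≡ - sgn m)
                      (sym (ℕP.+-∸-assoc 1 j<N)) (alternating-binomial-sum (N ℕ.∸ suc j))
  factor : ∀ i → i < N ℕ.∸ j →
           ℕ→ℚ (N C (j ℕ.+ i)) * sgn (j ℕ.+ i) * ℕ→ℚ ((j ℕ.+ i) C j) ≡ c * sgn j * (ℕ→ℚ ((N ℕ.∸ j) C i) * sgn i)
  factor i i<N∸j = begin
    ℕ→ℚ (N C (j ℕ.+ i)) * sgn (j ℕ.+ i) * ℕ→ℚ ((j ℕ.+ i) C j)
      ≡⟨ swapLast (ℕ→ℚ (N C (j ℕ.+ i))) (sgn (j ℕ.+ i)) (ℕ→ℚ ((j ℕ.+ i) C j)) ⟩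
    ℕ→ℚ (N C (j ℕ.+ i)) * ℕ→ℚ ((j ℕ.+ i) C j) * sgn (j ℕ.+ i)
      ≡⟨ cong₂ _*_ binomials (sgn-+ j i) ⟩
    c * ℕ→ℚ ((N ℕ.∸ j) C i) * (sgn j * sgn i)
      ≡⟨ swap c (ℕ→ℚ ((N ℕ.∸ j) C i)) (sgn j) (sgn i) ⟩
    c * sgn j * (ℕ→ℚ ((N ℕ.∸ j) C i) * sgn i) ∎
    where
    j+i≤N : j ℕ.+ i ≤ N
    j+i≤N = subst (_≤ N) (ℕP.+-comm i j) (ℕP.m≤o∸n⇒m+n≤o i (ℕP.<⇒≤ j<N) (ℕP.<⇒≤ i<N∸j))
    binomials : ℕ→ℚ (N C (j ℕ.+ i)) * ℕ→ℚ ((j ℕ.+ i) C j) ≡ c * ℕ→ℚ ((N ℕ.∸ j) C i)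
    binomials = begin
      ℕ→ℚ (N C (j ℕ.+ i)) * ℕ→ℚ ((j ℕ.+ i) C j)  ≡⟨ ℕ→ℚ-* (N C (j ℕ.+ i)) ((j ℕ.+ i) C j) ⟨
      ℕ→ℚ ((N C (j ℕ.+ i)) ℕ.* ((j ℕ.+ i) C j))  ≡⟨ cong ℕ→ℚ (nC[j+i]*[j+i]Cj≡nCj*[n∸j]Ci N j i j+i≤N) ⟩
      ℕ→ℚ ((N C j) ℕ.* ((N ℕ.∸ j) C i))          ≡⟨ ℕ→ℚ-* (N C j) ((N ℕ.∸ j) C i) ⟩
      c * ℕ→ℚ ((N ℕ.∸ j) C i)                    ∎
    swapLast : ∀ a s b → a * s * b ≡ a * b * s
    swapLast = solve-∀ ℚ-ring
    swap : ∀ a b s t → a * b * (s * t) ≡ a * s * (b * t)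
    swap = solve-∀ ℚ-ring

Σ-binomial-sgn*B⁺≡δ₁ : ∀ N → Σ N (λ k → ℕ→ℚ (N C k) * (sgn k * B⁺ k)) ≡ δ₁ N
Σ-binomial-sgn*B⁺≡δ₁ N = begin
  Σ N (λ k → ℕ→ℚ (N C k) * (sgn k * B⁺ k))
    ≡⟨ Σ-cong′ N expand ⟩
  Σ N (λ k → Σ (suc k) (F k))
    ≡⟨ Σ-exchange N F ⟩
  Σ N (λ j → Σ (N ℕ.∸ j) (λ i → F (j ℕ.+ i) j))
    ≡⟨ Σ-cong′ N (λ j → trans (Σ-cong′ (N ℕ.∸ j) (λ i → regroup (ℕ→ℚ (N C (j ℕ.+ i))) (sgn (j ℕ.+ i)) (ℕ→ℚ ((j ℕ.+ i) C j)) (B j)))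
                               (Σ-*ʳ (N ℕ.∸ j) (B j) (chain j))) ⟩
  Σ N (λ j → Σ (N ℕ.∸ j) (chain j) * B j)
    ≡⟨ Σ-cong N (λ j j<N → cong (_* B j) (Σ-binomial-chain j<N)) ⟩
  Σ N (λ j → - sgn N * ℕ→ℚ (N C j) * B j)
    ≡⟨ Σ-cong′ N (λ j → ℚP.*-assoc (- sgn N) (ℕ→ℚ (N C j)) (B j)) ⟩
  Σ N (λ j → - sgn N * (ℕ→ℚ (N C j) * B j))
    ≡⟨ Σ-*ˡ N (- sgn N) (λ j → ℕ→ℚ (N C j) * B j) ⟩
  - sgn N * Σ N (λ j → ℕ→ℚ (N C j) * B j)
    ≡⟨ cong (- sgn N *_) (Σ-binomial-B≡δ₁ N) ⟩
  - sgn N * δ₁ N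
    ≡⟨ sgn-δ₁ N ⟩
  δ₁ N ∎
  where
  open ≡-Reasoning
  chain : ℕ → ℕ → ℚ
  chain j i = ℕ→ℚ (N C (j ℕ.+ i)) * sgn (j ℕ.+ i) * ℕ→ℚ ((j ℕ.+ i) C j)
  F : ℕ → ℕ → ℚ
  F k j = ℕ→ℚ (N C k) * sgn k * (ℕ→ℚ (k C j) * B j)
  expand : ∀ k → ℕ→ℚ (N C k) * (sgn k * B⁺ k) ≡ Σ (suc k) (F k)
  expand k = trans (sym (ℚP.*-assoc (ℕ→ℚ (N C k)) (sgn k) (B⁺ k)))
                   (sym (Σ-*ˡ (suc k) (ℕ→ℚ (N C k) * sgn k) (λ j → ℕ→ℚ (k C j) * B j)))
  regroup : ∀ a s b β → a * s * (b * β) ≡ a * s * b * β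
  regroup = solve-∀ ℚ-ring
  sgn-δ₁ : ∀ N → - sgn N * δ₁ N ≡ δ₁ N
  sgn-δ₁ zero = refl
  sgn-δ₁ (suc zero) = refl
  sgn-δ₁ (suc (suc N)) = ℚP.*-zeroʳ (- sgn (suc (suc N)))

binomial-transform-injective : ∀ (x y : ℕ → ℚ) →
  (∀ N → Σ N (λ k → ℕ→ℚ (N C k) * x k) ≡ Σ N (λ k → ℕ→ℚ (N C k) * y k)) → ∀ k → x k ≡ y k
binomial-transform-injective x y transform-eq = <-rec (λ k → x k ≡ y k) step
  where
  step : ∀ k → (∀ {i} → i < k → x i ≡ y i) → x k ≡ y k
  step k below = ℕ→ℚ-*-cancelˡ k (x k) (y k) (∙-cancelˡ (Σ k (term x)) _ _ (begin
    Σ k (term x) + ℕ→ℚ (suc k) * x k   ≡⟨ cong (λ c → Σ k (term x) + ℕ→ℚ c * x k) ([1+n]Cn≡1+n k) ⟨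
    Σ k (term x) + term x k            ≡⟨ Σ-snoc k (term x) ⟨
    Σ (suc k) (term x)                 ≡⟨ transform-eq (suc k) ⟩
    Σ (suc k) (term y)                 ≡⟨ Σ-snoc k (term y) ⟩
    Σ k (term y) + term y k            ≡⟨ cong₂ _+_ (sym lower-terms) (cong (λ c → ℕ→ℚ c * y k) ([1+n]Cn≡1+n k)) ⟩
    Σ k (term x) + ℕ→ℚ (suc k) * y k   ∎))
    where
    open ≡-Reasoning
    term : (ℕ → ℚ) → ℕ → ℚ
    term z i = ℕ→ℚ (suc k C i) * z i
    lower-terms : Σ k (term x) ≡ Σ k (term y)
    lower-terms = Σ-cong k (λ i i<k → cong (ℕ→ℚ (suc k C i) *_) (below i<k))

B⁺≡sgn*B : ∀ n → B⁺ n ≡ sgn n * B n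
B⁺≡sgn*B n = begin
  B⁺ n                     ≡⟨ ℚP.*-identityˡ (B⁺ n) ⟨
  1ℚ * B⁺ n                ≡⟨ cong (_* B⁺ n) (sgn*sgn≡1 n) ⟨
  (sgn n * sgn n) * B⁺ n   ≡⟨ ℚP.*-assoc (sgn n) (sgn n) (B⁺ n) ⟩
  sgn n * (sgn n * B⁺ n)   ≡⟨ cong (sgn n *_) (binomial-transform-injective (λ k → sgn k * B⁺ k) B same-transform n) ⟩
  sgn n * B n              ∎
  where
  open ≡-Reasoning
  same-transform : ∀ N → Σ N (λ k → ℕ→ℚ (N C k) * (sgn k * B⁺ k)) ≡ Σ N (λ k → ℕ→ℚ (N C k) * B k)
  same-transform N = trans (Σ-binomial-sgn*B⁺≡δ₁ N) (sym (Σ-binomial-B≡δ₁ N))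

-- Sadaoui's sum as an iterated binomial operator

step : (ℕ → ℚ) → ℕ → (ℕ → ℚ) → ℕ → ℚ
step w x h m = recip m * Σ (suc m) (λ k → ℕ→ℚ (m C k) * w k * h (suc x ℕ.+ m ℕ.∸ k))

steps : (ℕ → ℚ) → ℕ → List ℕ → (ℕ → ℚ) → ℚ
steps w x [] h = h (suc x)
steps w x (n ∷ ns) h = steps w n ns (step w x h)

steps-cong : ∀ w x ns {h h′ : ℕ → ℚ} → (∀ m → h m ≡ h′ m) → steps w x ns h ≡ steps w x ns h′
steps-cong w x [] eq = eq (suc x)
steps-cong w x (n ∷ ns) eq = steps-cong w n ns (λ m →
  cong (recip m *_) (Σ-cong′ (suc m) (λ k → cong (ℕ→ℚ (m C k) * w k *_) (eq (suc x ℕ.+ m ℕ.∸ k)))))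

nest-∷ : ∀ k ks → nest (k ∷ ks) ≡ B⁺ k * nest ks
nest-∷ k ks = trans (Σ≤≡Σ k (λ l → ℕ→ℚ (k C l) * B l * nest ks)) (Σ-*ʳ (suc k) (nest ks) (λ l → ℕ→ℚ (k C l) * B l))

mOf-∷ : ∀ x L k ks → sum ks ≤ sum L ℕ.+ length L → mOf (x ∷ L) (k ∷ ks) ≡ suc x ℕ.+ mOf L ks ℕ.∸ k
mOf-∷ x L k ks ks≤L = begin
  (x ℕ.+ sum L ℕ.+ suc (length L)) ℕ.∸ (k ℕ.+ sum ks)     ≡⟨ cong ((x ℕ.+ sum L ℕ.+ suc (length L)) ℕ.∸_) (ℕP.+-comm k (sum ks)) ⟩
  (x ℕ.+ sum L ℕ.+ suc (length L)) ℕ.∸ (sum ks ℕ.+ k)     ≡⟨ ℕP.∸-+-assoc (x ℕ.+ sum L ℕ.+ suc (length L)) (sum ks) k ⟨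
  (x ℕ.+ sum L ℕ.+ suc (length L)) ℕ.∸ sum ks ℕ.∸ k       ≡⟨ cong (λ z → z ℕ.∸ sum ks ℕ.∸ k) (regroup x (sum L) (length L)) ⟩
  (suc x ℕ.+ (sum L ℕ.+ length L)) ℕ.∸ sum ks ℕ.∸ k       ≡⟨ cong (ℕ._∸ k) (ℕP.+-∸-assoc (suc x) ks≤L) ⟩
  suc x ℕ.+ mOf L ks ℕ.∸ k                                ∎
  where
  open ≡-Reasoning
  regroup : ∀ x s t → x ℕ.+ s ℕ.+ suc t ≡ suc x ℕ.+ (s ℕ.+ t)
  regroup = ℕSolver.solve-∀

-- If sum ks exceeds the bound (never the case for tuples), m truncates to 0 and both sides vanish
-- because recip 0 = 0.
step-mOf : ∀ w x L ks (h : ℕ → ℚ) →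
  recip (mOf L ks) * Σ (suc (mOf L ks)) (λ k → ℕ→ℚ (mOf L ks C k) * w k * h (mOf (x ∷ L) (k ∷ ks)))
    ≡ step w x h (mOf L ks)
step-mOf w x L ks h with ℕP.≤-total (sum ks) (sum L ℕ.+ length L)
... | inj₁ ks≤L = cong (recip (mOf L ks) *_) (Σ-cong′ (suc (mOf L ks)) (λ k →
        cong (λ z → ℕ→ℚ (mOf L ks C k) * w k * h z) (mOf-∷ x L k ks ks≤L)))
... | inj₂ L≤ks = trans (vanish _) (sym (vanish _))
  where
  vanish : ∀ s → recip (mOf L ks) * s ≡ 0ℚ
  vanish s = trans (cong (λ m → recip m * s) (ℕP.m≤n⇒m∸n≡0 L≤ks)) (ℚP.*-zeroˡ s)

Σ-tuples≡steps : ∀ ns x (h : ℕ → ℚ) →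
  sumℚ (map (λ ks → prodW ns ks * nest ks * h (mOf (x ∷ ns) ks)) (tuples ns)) ≡ steps B⁺ x ns h
Σ-tuples≡steps [] x h = trans (unit (h (x ℕ.+ 0 ℕ.+ 1))) (cong h (x+0+1≡1+x x))
  where
  unit : ∀ y → 1ℚ * 1ℚ * y + 0ℚ ≡ y
  unit = solve-∀ ℚ-ring
  x+0+1≡1+x : ∀ x → x ℕ.+ 0 ℕ.+ 1 ≡ suc x
  x+0+1≡1+x = ℕSolver.solve-∀
Σ-tuples≡steps (n ∷ ns) x h = begin
  sumℚ (map f (concatMap extensions (tuples ns)))                     ≡⟨ sumℚ-concatMap f extensions (tuples ns) ⟩
  sumℚ (map (λ ks → sumℚ (map f (extensions ks))) (tuples ns))        ≡⟨ cong sumℚ (List.map-cong inner (tuples ns)) ⟩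
  sumℚ (map (λ ks → prodW ns ks * nest ks * step B⁺ x h (mOf (n ∷ ns) ks)) (tuples ns)) ≡⟨ Σ-tuples≡steps ns n (step B⁺ x h) ⟩
  steps B⁺ n ns (step B⁺ x h)                                         ∎
  where
  open ≡-Reasoning
  f : List ℕ → ℚ
  f ks = prodW (n ∷ ns) ks * nest ks * h (mOf (x ∷ n ∷ ns) ks)
  extensions : List ℕ → List (List ℕ)
  extensions ks = map (_∷ ks) (upTo (suc (mOf (n ∷ ns) ks)))
  regroup : ∀ c r p b q y → (c * r * p) * (b * q) * y ≡ r * (p * q * (c * b * y))
  regroup = solve-∀ ℚ-ring
  inner : ∀ ks → sumℚ (map f (extensions ks)) ≡ prodW ns ks * nest ks * step B⁺ x h (mOf (n ∷ ns) ks)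
  inner ks = begin
    sumℚ (map f (extensions ks))                ≡⟨ cong sumℚ (List.map-∘ {g = f} {f = _∷ ks} (upTo (suc m))) ⟨
    sumℚ (map (λ k → f (k ∷ ks)) (upTo (suc m))) ≡⟨ sumℚ-map-upTo (suc m) (λ k → f (k ∷ ks)) ⟩
    Σ (suc m) (λ k → f (k ∷ ks))                 ≡⟨ Σ-cong′ (suc m) factor ⟩
    Σ (suc m) (λ k → recip m * (p * q * t k))    ≡⟨ Σ-*ˡ (suc m) (recip m) (λ k → p * q * t k) ⟩
    recip m * Σ (suc m) (λ k → p * q * t k)      ≡⟨ cong (recip m *_) (Σ-*ˡ (suc m) (p * q) t) ⟩
    recip m * (p * q * Σ (suc m) t)              ≡⟨ commute (recip m) (p * q) (Σ (suc m) t) ⟩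
    p * q * (recip m * Σ (suc m) t)              ≡⟨ cong (p * q *_) (step-mOf B⁺ x (n ∷ ns) ks h) ⟩
    p * q * step B⁺ x h m                        ∎
    where
    m = mOf (n ∷ ns) ks
    p = prodW ns ks
    q = nest ks
    t : ℕ → ℚ
    t k = ℕ→ℚ (m C k) * B⁺ k * h (mOf (x ∷ n ∷ ns) (k ∷ ks))
    factor : ∀ k → f (k ∷ ks) ≡ recip m * (p * q * t k)
    factor k = trans (cong (λ z → (ℕ→ℚ (m C k) * recip m * p) * z * h (mOf (x ∷ n ∷ ns) (k ∷ ks))) (nest-∷ k ks))
                     (regroup (ℕ→ℚ (m C k)) (recip m) p (B⁺ k) q (h (mOf (x ∷ n ∷ ns) (k ∷ ks))))
    commute : ∀ r a s → r * (a * s) ≡ a * (r * s)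
    commute = solve-∀ ℚ-ring

-- B⁺ₖ = (-1)ᵏ Bₖ and k ≤ x + 1 + m, so the signs of each term combine to one independent of k.
step-B⁺-sgn : ∀ x c g m → step B⁺ x (λ m′ → sgn (c ℕ.+ m′) * g m′) m ≡ sgn (c ℕ.+ suc x ℕ.+ m) * step B x g m
step-B⁺-sgn x c g m = begin
  recip m * Σ (suc m) (λ k → ℕ→ℚ (m C k) * B⁺ k * (sgn (c ℕ.+ e k) * g (e k)))
    ≡⟨ cong (recip m *_) (Σ-cong (suc m) term) ⟩
  recip m * Σ (suc m) (λ k → s * (ℕ→ℚ (m C k) * B k * g (e k)))
    ≡⟨ cong (recip m *_) (Σ-*ˡ (suc m) s (λ k → ℕ→ℚ (m C k) * B k * g (e k))) ⟩
  recip m * (s * Σ (suc m) (λ k → ℕ→ℚ (m C k) * B k * g (e k)))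
    ≡⟨ commute (recip m) s _ ⟩
  s * step B x g m ∎
  where
  open ≡-Reasoning
  s = sgn (c ℕ.+ suc x ℕ.+ m)
  e : ℕ → ℕ
  e k = suc x ℕ.+ m ℕ.∸ k
  commute : ∀ r a t → r * (a * t) ≡ a * (r * t)
  commute = solve-∀ ℚ-ring
  regroup : ∀ b u v y z → b * (u * v) * (y * z) ≡ (u * y) * (b * v * z)
  regroup = solve-∀ ℚ-ring
  reshuffle : ∀ k c r → k ℕ.+ (c ℕ.+ r) ≡ c ℕ.+ (k ℕ.+ r)
  reshuffle = ℕSolver.solve-∀
  exponent : ∀ k → k ≤ suc x ℕ.+ m → k ℕ.+ (c ℕ.+ e k) ≡ c ℕ.+ suc x ℕ.+ m
  exponent k k≤ = trans (reshuffle k c (e k)) (trans (cong (c ℕ.+_) (ℕP.m+[n∸m]≡n k≤)) (sym (ℕP.+-assoc c (suc x) m)))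
  term : ∀ k → k < suc m → ℕ→ℚ (m C k) * B⁺ k * (sgn (c ℕ.+ e k) * g (e k)) ≡ s * (ℕ→ℚ (m C k) * B k * g (e k))
  term k (s≤s k≤m) = begin
    ℕ→ℚ (m C k) * B⁺ k * (sgn (c ℕ.+ e k) * g (e k))          ≡⟨ cong (λ b → ℕ→ℚ (m C k) * b * (sgn (c ℕ.+ e k) * g (e k))) (B⁺≡sgn*B k) ⟩
    ℕ→ℚ (m C k) * (sgn k * B k) * (sgn (c ℕ.+ e k) * g (e k)) ≡⟨ regroup (ℕ→ℚ (m C k)) (sgn k) (B k) (sgn (c ℕ.+ e k)) (g (e k)) ⟩
    (sgn k * sgn (c ℕ.+ e k)) * (ℕ→ℚ (m C k) * B k * g (e k)) ≡⟨ cong (_* (ℕ→ℚ (m C k) * B k * g (e k))) (sym (sgn-+ k (c ℕ.+ e k))) ⟩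
    sgn (k ℕ.+ (c ℕ.+ e k)) * (ℕ→ℚ (m C k) * B k * g (e k))  ≡⟨ cong (λ z → sgn z * (ℕ→ℚ (m C k) * B k * g (e k)))
                                                                      (exponent k (ℕP.≤-trans k≤m (ℕP.m≤n+m m (suc x)))) ⟩
    s * (ℕ→ℚ (m C k) * B k * g (e k))                        ∎

steps-B⁺-sgn : ∀ ns x c g →
  steps B⁺ x ns (λ m → sgn (c ℕ.+ m) * g m) ≡ sgn (c ℕ.+ (sum (x ∷ ns) ℕ.+ length (x ∷ ns))) * steps B x ns g
steps-B⁺-sgn [] x c g = cong (λ e → sgn e * g (suc x)) (exponent c x)
  where
  exponent : ∀ c x → c ℕ.+ suc x ≡ c ℕ.+ (x ℕ.+ 0 ℕ.+ 1)
  exponent = ℕSolver.solve-∀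
steps-B⁺-sgn (n ∷ ns) x c g = begin
  steps B⁺ n ns (step B⁺ x (λ m → sgn (c ℕ.+ m) * g m))
    ≡⟨ steps-cong B⁺ n ns (step-B⁺-sgn x c g) ⟩
  steps B⁺ n ns (λ m → sgn (c ℕ.+ suc x ℕ.+ m) * step B x g m)
    ≡⟨ steps-B⁺-sgn ns n (c ℕ.+ suc x) (step B x g) ⟩
  sgn (c ℕ.+ suc x ℕ.+ (n ℕ.+ sum ns ℕ.+ suc (length ns))) * steps B n ns (step B x g)
    ≡⟨ cong (λ e → sgn e * steps B n ns (step B x g)) (exponent c x n (sum ns) (length ns)) ⟩
  sgn (c ℕ.+ (x ℕ.+ (n ℕ.+ sum ns) ℕ.+ suc (suc (length ns)))) * steps B n ns (step B x g) ∎
  where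
  open ≡-Reasoning
  exponent : ∀ c x n s l → c ℕ.+ suc x ℕ.+ (n ℕ.+ s ℕ.+ suc l) ≡ c ℕ.+ (x ℕ.+ (n ℕ.+ s) ℕ.+ suc (suc l))
  exponent = ℕSolver.solve-∀

-- The symbolic evaluation V

B/n : ℕ → ℚ
B/n m = B m * recip m

Vh : ℕ → List ℕ → (ℕ → ℚ) → ℚ
Vh a [] g = g a
Vh a (b ∷ rest) g = recip a * Σ≤ a (λ j → ℕ→ℚ (a C j) * B (a ℕ.∸ j) * Vh (b ℕ.+ j) rest g)

Vrev≡Vh : ∀ a rest → Vrev a rest ≡ Vh a rest B/n
Vrev≡Vh a [] = refl
Vrev≡Vh a (b ∷ rest) = cong (recip a *_) (cong sumℚ (List.map-cong (λ j →
  cong (ℕ→ℚ (a C j) * B (a ℕ.∸ j) *_) (Vrev≡Vh (b ℕ.+ j) rest)) (upTo (suc a))))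

step-B-reversed : ∀ x g a → step B x g a ≡ recip a * Σ≤ a (λ j → ℕ→ℚ (a C j) * B (a ℕ.∸ j) * g (suc x ℕ.+ j))
step-B-reversed x g a = cong (recip a *_) (begin
  Σ (suc a) t                                                        ≡⟨ Σ-reverse (suc a) t ⟩
  Σ (suc a) (λ j → t (a ℕ.∸ j))                                      ≡⟨ Σ-cong (suc a) reindex ⟩
  Σ (suc a) (λ j → ℕ→ℚ (a C j) * B (a ℕ.∸ j) * g (suc x ℕ.+ j))      ≡⟨ Σ≤≡Σ a (λ j → ℕ→ℚ (a C j) * B (a ℕ.∸ j) * g (suc x ℕ.+ j)) ⟨
  Σ≤ a (λ j → ℕ→ℚ (a C j) * B (a ℕ.∸ j) * g (suc x ℕ.+ j))           ∎)
  where
  open ≡-Reasoning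
  t : ℕ → ℚ
  t k = ℕ→ℚ (a C k) * B k * g (suc x ℕ.+ a ℕ.∸ k)
  argument : ∀ j → j ≤ a → suc x ℕ.+ a ℕ.∸ (a ℕ.∸ j) ≡ suc x ℕ.+ j
  argument j j≤a = begin
    suc x ℕ.+ a ℕ.∸ (a ℕ.∸ j)                   ≡⟨ cong (λ z → suc x ℕ.+ z ℕ.∸ (a ℕ.∸ j)) (ℕP.m+[n∸m]≡n j≤a) ⟨
    suc x ℕ.+ (j ℕ.+ (a ℕ.∸ j)) ℕ.∸ (a ℕ.∸ j)   ≡⟨ cong (ℕ._∸ (a ℕ.∸ j)) (ℕP.+-assoc (suc x) j (a ℕ.∸ j)) ⟨
    suc x ℕ.+ j ℕ.+ (a ℕ.∸ j) ℕ.∸ (a ℕ.∸ j)     ≡⟨ ℕP.m+n∸n≡m (suc x ℕ.+ j) (a ℕ.∸ j) ⟩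
    suc x ℕ.+ j                                 ∎
  reindex : ∀ j → j < suc a → t (a ℕ.∸ j) ≡ ℕ→ℚ (a C j) * B (a ℕ.∸ j) * g (suc x ℕ.+ j)
  reindex j (s≤s j≤a) = cong₂ (λ c e → ℕ→ℚ c * B (a ℕ.∸ j) * g e) (sym (nCk≡nC[n∸k] j≤a)) (argument j j≤a)

Vh-∷ʳ : ∀ a rest x g → Vh a (rest ∷ʳ suc x) g ≡ Vh a rest (step B x g)
Vh-∷ʳ a [] x g = sym (step-B-reversed x g a)
Vh-∷ʳ a (b ∷ rest) x g = cong (recip a *_) (cong sumℚ (List.map-cong (λ j →
  cong (ℕ→ℚ (a C j) * B (a ℕ.∸ j) *_) (Vh-∷ʳ (b ℕ.+ j) rest x g)) (upTo (suc a))))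

VL : List ℕ → (ℕ → ℚ) → ℚ
VL [] g = 1ℚ
VL (a ∷ rest) g = Vh a rest g

V≡VL : ∀ as → V as ≡ VL (reverse as) B/n
V≡VL as with reverse as
... | [] = refl
... | a ∷ rest = Vrev≡Vh a rest

VL-∷ʳ-∷ʳ : ∀ as b x g → VL ((as ∷ʳ b) ∷ʳ suc x) g ≡ VL (as ∷ʳ b) (step B x g)
VL-∷ʳ-∷ʳ [] b x g = Vh-∷ʳ b [] x g
VL-∷ʳ-∷ʳ (a ∷ as) b x g = Vh-∷ʳ a (as ∷ʳ b) x g

steps-B≡VL : ∀ ns x g → steps B x ns g ≡ VL (reverse (map suc (x ∷ ns))) g
steps-B≡VL [] x g = refl
steps-B≡VL (n ∷ ns) x g = begin
  steps B n ns (step B x g)                                 ≡⟨ steps-B≡VL ns n (step B x g) ⟩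
  VL (reverse (map suc (n ∷ ns))) (step B x g)              ≡⟨ cong (λ l → VL l (step B x g)) (List.unfold-reverse (suc n) (map suc ns)) ⟩
  VL (reverse (map suc ns) ∷ʳ suc n) (step B x g)           ≡⟨ VL-∷ʳ-∷ʳ (reverse (map suc ns)) (suc n) x g ⟨
  VL ((reverse (map suc ns) ∷ʳ suc n) ∷ʳ suc x) g           ≡⟨ cong (λ l → VL (l ∷ʳ suc x) g) (List.unfold-reverse (suc n) (map suc ns)) ⟨
  VL (reverse (map suc (n ∷ ns)) ∷ʳ suc x) g                ≡⟨ cong (λ l → VL l g) (List.unfold-reverse (suc x) (map suc (n ∷ ns))) ⟨
  VL (reverse (map suc (x ∷ n ∷ ns))) g                     ∎
  where open ≡-Reasoning

zetaNeg≡steps : ∀ n₁ ns → zetaNeg (n₁ ∷ ns) ≡ sgn (length (n₁ ∷ ns)) * steps B⁺ n₁ ns (λ m → sgn m * B/n m)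
zetaNeg≡steps n₁ ns = cong (sgn (length (n₁ ∷ ns)) *_)
  (trans (cong sumℚ (List.map-cong summand (tuples ns))) (Σ-tuples≡steps ns n₁ (λ m → sgn m * B/n m)))
  where
  open ≡-Reasoning
  regroup : ∀ r p s b q → r * p * ((s * b) * q) ≡ p * q * (s * (b * r))
  regroup = solve-∀ ℚ-ring
  summand : ∀ ks → let m = mOf (n₁ ∷ ns) ks in
    recip m * prodW ns ks * Σ≤ m (λ l → ℕ→ℚ (m C l) * B l * nest ks) ≡ prodW ns ks * nest ks * (sgn m * B/n m)
  summand ks = begin
    recip m * prodW ns ks * Σ≤ m (λ l → ℕ→ℚ (m C l) * B l * nest ks)
      ≡⟨ cong (recip m * prodW ns ks *_) (trans (Σ≤≡Σ m (λ l → ℕ→ℚ (m C l) * B l * nest ks)) (Σ-*ʳ (suc m) (nest ks) (λ l → ℕ→ℚ (m C l) * B l))) ⟩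
    recip m * prodW ns ks * (B⁺ m * nest ks)
      ≡⟨ cong (λ b → recip m * prodW ns ks * (b * nest ks)) (B⁺≡sgn*B m) ⟩
    recip m * prodW ns ks * ((sgn m * B m) * nest ks)
      ≡⟨ regroup (recip m) (prodW ns ks) (sgn m) (B m) (nest ks) ⟩
    prodW ns ks * nest ks * (sgn m * B/n m) ∎
    where m = mOf (n₁ ∷ ns) ks

theorem1 : (n₁ : ℕ) (ns : List ℕ) →
    zetaNeg (n₁ ∷ ns) ≡ sgn (sum (n₁ ∷ ns)) * V (map suc (n₁ ∷ ns))
theorem1 n₁ ns = begin
  zetaNeg (n₁ ∷ ns)                                ≡⟨ zetaNeg≡steps n₁ ns ⟩
  sgn r * steps B⁺ n₁ ns (λ m → sgn m * B/n m)     ≡⟨ cong (sgn r *_) (steps-B⁺-sgn ns n₁ 0 B/n) ⟩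
  sgn r * (sgn (s ℕ.+ r) * steps B n₁ ns B/n)      ≡⟨ sgn-absorb s r (steps B n₁ ns B/n) ⟩
  sgn s * steps B n₁ ns B/n                        ≡⟨ cong (sgn s *_) (steps-B≡VL ns n₁ B/n) ⟩
  sgn s * VL (reverse (map suc (n₁ ∷ ns))) B/n     ≡⟨ cong (sgn s *_) (V≡VL (map suc (n₁ ∷ ns))) ⟨
  sgn s * V (map suc (n₁ ∷ ns))                    ∎
  where
  open ≡-Reasoning
  r = length (n₁ ∷ ns)
  s = sum (n₁ ∷ ns)
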